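{- For any non-complete finite simple graph $G$ of order $n$ with $\delta(G)\geq 1$, $\alpha^*(G)\leq \frac{2(n-1)}{\sigma_2(G)}$.
   Context: $\sigma_2(G)=\min\{d_G(u)+d_G(v): u\ne v,\ uv\notin E(G)\}$. An independent set $I$ of $G$ means a nonempty set of pairwise non-adjacent vertices; $w_G(I)=\sum_{u\in I}d_G(u)$; $I$ is light if $w_G(I)\leq n-1$. $\alpha^*(G)=\max\{|I|: I\text{ a light independent set of }G\}$. -}

module Defs where

open import Data.Nat using (ℕ; _+_; _*_; _∸_; _≤_)
open import Data.Bool using (Bool; true; false; if_then_else_)
open import Data.Fin using (Fin)
open import Data.Fin.Subset using (Subset; _∈_; ∣_∣; Nonempty)
open import Data.List using (List; map; allFin)
open import Data.Nat.ListAction using (sum)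
open import Data.Product using (Σ; _×_; ∃; ∃-syntax)
open import Relation.Binary.PropositionalEquality using (_≡_; _≢_)

record Graph (n : ℕ) : Set where
  field
    adj   : Fin n → Fin n → Bool
    sym   : ∀ u v → adj u v ≡ adj v u
    irrefl : ∀ u → adj u u ≡ false
open Graph public

deg : ∀ {n} → Graph n → Fin n → ℕ
deg {n} G u = sum (map (λ v → if adj G u v then 1 else 0) (allFin n))

MinDegAtLeast : ∀ {n} → Graph n → ℕ → Set
MinDegAtLeast G k = ∀ u → k ≤ deg G u

IsComplete : ∀ {n} → Graph n → Set
IsComplete G = ∀ u v → u ≢ v → adj G u v ≡ true

IsSigma2 : ∀ {n} → Graph n → ℕ → Set
IsSigma2 G s =
  (∃[ u ] ∃[ v ] (u ≢ v × adj G u v ≡ false × deg G u + deg G v ≡ s))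
  × (∀ u v → u ≢ v → adj G u v ≡ false → s ≤ deg G u + deg G v)

IsIndependent : ∀ {n} → Graph n → Subset n → Set
IsIndependent G I = Nonempty I × (∀ u v → u ∈ I → v ∈ I → adj G u v ≡ false)

weight : ∀ {n} → Graph n → Subset n → ℕ
weight {n} G I = sum (map (λ u → if Data.Vec.lookup I u then deg G u else 0) (allFin n))
  where import Data.Vec

IsLight : ∀ {n} → Graph n → Subset n → Set
IsLight {n} G I = IsIndependent G I × weight G I ≤ n ∸ 1

IsAlphaStar : ∀ {n} → Graph n → ℕ → Set
IsAlphaStar G a =
  (∃[ I ] (IsLight G I × ∣ I ∣ ≡ a))
  × (∀ I → IsLight G I → ∣ I ∣ ≤ a)

-- Let I be a maximum light independent set and a = |I|. For a ≤ 1 the bound reduces to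
-- σ₂ ≤ 2(n − 1), which holds because every degree is at most n − 1. For a ≥ 2, either every
-- u ∈ I has 2d(u) ≥ σ₂, and summing over I gives aσ₂ ≤ 2w(I); or some u ∈ I has 2d(u) < σ₂.
-- In the latter case every other v ∈ I is distinct from and non-adjacent to u, so
-- d(u) + d(v) ≥ σ₂; summing over I ∖ {u} and using 2d(u) ≤ σ₂ once more again yields
-- aσ₂ ≤ 2w(I). Lightness finally gives w(I) ≤ n − 1.
module Submission where

open import Defs hiding (sym)
open import Data.Nat using (ℕ; _*_; _∸_; _≤_)
open import Relation.Nullary using (¬_)

open import Data.Bool using (Bool; true; false; if_then_else_)
open import Data.Bool.Properties using (not-¬)
open import Data.Fin using (Fin; zero; suc)
open import Data.Fin.Properties using (any?)
open import Data.Fin.Subset using (Subset; _∈_; _∉_; _-_; ⊤; ∣_∣; _⊂_)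
open import Data.Fin.Subset.Properties
  using (_∈?_; ∈⊤; ∣⊤∣≡n; p⊂q⇒∣p∣<∣q∣; p─⊥≡p; p─q⊆p)
open import Data.List using (map; allFin) renaming (tabulate to tabulateᴸ)
open import Data.List.Properties using (map-tabulate)
open import Data.Nat using (zero; suc; _+_; _<_; z≤n; s≤s; s≤s⁻¹; _<?_)
open import Data.Nat.ListAction using (sum)
open import Data.Nat.Properties
open import Data.Nat.Tactic.RingSolver using (solve-∀)
open import Data.Product using (_,_)
open import Data.Vec using ([]; _∷_; lookup; tabulate; here; there)
open import Data.Vec.Properties using (tabulate∘lookup; lookup∘tabulate; []=⇒lookup)
open import Function using (_∘_; id)
open import Relation.Binary.PropositionalEquality
open import Relation.Nullary using (yes; no)
open import Relation.Nullary.Decidable using (_×-dec_)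
open import Algebra.Properties.CommutativeSemigroup +-commutativeSemigroup
  using (interchange; x∙yz≈y∙xz)

subsetSum : ∀ {n} → Subset n → (Fin n → ℕ) → ℕ
subsetSum []      f = 0
subsetSum (b ∷ p) f = (if b then f zero else 0) + subsetSum p (f ∘ suc)

syntax subsetSum p (λ x → e) = ∑[ x ∈ p ] e

∑∈-mono-≤ : ∀ {n} (p : Subset n) {f g : Fin n → ℕ} →
            (∀ {x} → x ∈ p → f x ≤ g x) → subsetSum p f ≤ subsetSum p g
∑∈-mono-≤ []          f≤g = z≤n
∑∈-mono-≤ (true ∷ p)  f≤g = +-mono-≤ (f≤g here) (∑∈-mono-≤ p (f≤g ∘ there))
∑∈-mono-≤ (false ∷ p) f≤g = ∑∈-mono-≤ p (f≤g ∘ there)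

∑∈-const : ∀ {n} (p : Subset n) c → ∑[ _ ∈ p ] c ≡ ∣ p ∣ * c
∑∈-const []          c = refl
∑∈-const (true ∷ p)  c = cong (c +_) (∑∈-const p c)
∑∈-const (false ∷ p) c = ∑∈-const p c

∑∈-distrib-+ : ∀ {n} (p : Subset n) (f g : Fin n → ℕ) →
               ∑[ x ∈ p ] (f x + g x) ≡ subsetSum p f + subsetSum p g
∑∈-distrib-+ []          f g = refl
∑∈-distrib-+ (true ∷ p)  f g = trans (cong (f zero + g zero +_) (∑∈-distrib-+ p _ _))
                                     (interchange (f zero) (g zero) _ _)
∑∈-distrib-+ (false ∷ p) f g = ∑∈-distrib-+ p (f ∘ suc) (g ∘ suc)

*-distribˡ-∑∈ : ∀ {n} (p : Subset n) c (f : Fin n → ℕ) →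
                c * subsetSum p f ≡ ∑[ x ∈ p ] (c * f x)
*-distribˡ-∑∈ []          c f = *-zeroʳ c
*-distribˡ-∑∈ (true ∷ p)  c f = trans (*-distribˡ-+ c (f zero) _)
                                      (cong (c * f zero +_) (*-distribˡ-∑∈ p c (f ∘ suc)))
*-distribˡ-∑∈ (false ∷ p) c f = *-distribˡ-∑∈ p c (f ∘ suc)

∑∈-remove : ∀ {n} {p : Subset n} {x} (f : Fin n → ℕ) → x ∈ p →
            subsetSum p f ≡ f x + subsetSum (p - x) f
∑∈-remove {p = true ∷ p} f here =
  cong (λ q → f zero + subsetSum q (f ∘ suc)) (sym (p─⊥≡p p))
∑∈-remove {p = b ∷ p} {suc x} f (there x∈p) =
  trans (cong ((if b then f zero else 0) +_) (∑∈-remove (f ∘ suc) x∈p))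
        (x∙yz≈y∙xz (if b then f zero else 0) (f (suc x)) (subsetSum (p - x) (f ∘ suc)))

∣p∣*c≤∑∈ : ∀ {n} (p : Subset n) {c} {f : Fin n → ℕ} →
           (∀ {x} → x ∈ p → c ≤ f x) → ∣ p ∣ * c ≤ subsetSum p f
∣p∣*c≤∑∈ p {c} c≤f = subst (_≤ _) (∑∈-const p c) (∑∈-mono-≤ p c≤f)

∣p∣≡1+∣p-x∣ : ∀ {n} {p : Subset n} {x} → x ∈ p → ∣ p ∣ ≡ suc ∣ p - x ∣
∣p∣≡1+∣p-x∣ {p = p} {x} x∈p = begin
  ∣ p ∣                  ≡⟨ *-identityʳ ∣ p ∣ ⟨
  ∣ p ∣ * 1              ≡⟨ ∑∈-const p 1 ⟨
  ∑[ _ ∈ p ] 1           ≡⟨ ∑∈-remove _ x∈p ⟩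
  suc (∑[ _ ∈ p - x ] 1) ≡⟨ cong suc (∑∈-const (p - x) 1) ⟩
  suc (∣ p - x ∣ * 1)    ≡⟨ cong suc (*-identityʳ ∣ p - x ∣) ⟩
  suc ∣ p - x ∣          ∎
  where open ≡-Reasoning

x∉p-x : ∀ {n} (p : Subset n) x → x ∉ p - x
x∉p-x (_ ∷ p) zero    ()
x∉p-x (_ ∷ p) (suc x) (there x∈p-x) = x∉p-x p x x∈p-x

sum-tabulate-if : ∀ {n} (b : Fin n → Bool) (f : Fin n → ℕ) →
                  sum (tabulateᴸ (λ x → if b x then f x else 0)) ≡ subsetSum (tabulate b) f
sum-tabulate-if {zero}   b f = refl
sum-tabulate-if {suc n}  b f =
  cong ((if b zero then f zero else 0) +_) (sum-tabulate-if (b ∘ suc) (f ∘ suc))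

sum-allFin-if : ∀ {n} (b : Fin n → Bool) (f : Fin n → ℕ) →
                sum (map (λ x → if b x then f x else 0) (allFin n)) ≡ subsetSum (tabulate b) f
sum-allFin-if {n} b f =
  trans (cong sum (map-tabulate {n = n} id (λ x → if b x then f x else 0))) (sum-tabulate-if b f)

[1+m]s≤2[x+w] : ∀ {m s x w} → 1 ≤ m → m * s ≤ m * x + w → 2 * x ≤ s → suc m * s ≤ 2 * (x + w)
[1+m]s≤2[x+w] {suc k} {s} {x} {w} _ ms≤mx+w 2x≤s = +-cancelʳ-≤ (k * (2 * x)) _ _ (begin
  (2 + k) * s + k * (2 * x) ≤⟨ +-monoʳ-≤ ((2 + k) * s) (*-monoʳ-≤ k 2x≤s) ⟩
  (2 + k) * s + k * s       ≡⟨ lhs k s ⟩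
  2 * (suc k * s)           ≤⟨ *-monoʳ-≤ 2 ms≤mx+w ⟩
  2 * (suc k * x + w)       ≡⟨ rhs k x w ⟩
  2 * (x + w) + k * (2 * x) ∎)
  where
  open ≤-Reasoning
  lhs : ∀ k s → (2 + k) * s + k * s ≡ 2 * (suc k * s)
  lhs = solve-∀
  rhs : ∀ k x w → 2 * (suc k * x + w) ≡ 2 * (x + w) + k * (2 * x)
  rhs = solve-∀

module PairwiseBound {n} (d : Fin n → ℕ) (p : Subset n) {s : ℕ}
  (pairwise : ∀ {u v} → u ∈ p → v ∈ p → u ≢ v → s ≤ d u + d v) where

  bound-if-all-high : (∀ {u} → u ∈ p → s ≤ 2 * d u) → ∣ p ∣ * s ≤ 2 * subsetSum p d
  bound-if-all-high high =
    subst (∣ p ∣ * s ≤_) (sym (*-distribˡ-∑∈ p 2 d)) (∣p∣*c≤∑∈ p high)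

  bound-if-low-vertex : ∀ {u} → u ∈ p → 2 * d u ≤ s → 2 ≤ ∣ p ∣ →
                          ∣ p ∣ * s ≤ 2 * subsetSum p d
  bound-if-low-vertex {u} u∈p 2du≤s 2≤∣p∣ = begin
    ∣ p ∣ * s                 ≡⟨ cong (_* s) ∣p∣≡1+∣q∣ ⟩
    suc ∣ q ∣ * s             ≤⟨ [1+m]s≤2[x+w] 1≤∣q∣ ∣q∣*s≤ 2du≤s ⟩
    2 * (d u + subsetSum q d) ≡⟨ cong (2 *_) (∑∈-remove d u∈p) ⟨
    2 * subsetSum p d         ∎
    where
    open ≤-Reasoning
    q : Subset n
    q = p - u
    ∣p∣≡1+∣q∣ : ∣ p ∣ ≡ suc ∣ q ∣
    ∣p∣≡1+∣q∣ = ∣p∣≡1+∣p-x∣ u∈p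
    1≤∣q∣ : 1 ≤ ∣ q ∣
    1≤∣q∣ = s≤s⁻¹ (subst (2 ≤_) ∣p∣≡1+∣q∣ 2≤∣p∣)
    pair-with-u : ∀ {v} → v ∈ q → s ≤ d u + d v
    pair-with-u v∈q = pairwise u∈p (p─q⊆p p _ v∈q) λ { refl → x∉p-x p u v∈q }
    ∣q∣*s≤ : ∣ q ∣ * s ≤ ∣ q ∣ * d u + subsetSum q d
    ∣q∣*s≤ = begin
      ∣ q ∣ * s                       ≤⟨ ∣p∣*c≤∑∈ q pair-with-u ⟩
      ∑[ v ∈ q ] (d u + d v)          ≡⟨ ∑∈-distrib-+ q _ d ⟩
      ∑[ _ ∈ q ] d u + subsetSum q d  ≡⟨ cong (_+ subsetSum q d) (∑∈-const q (d u)) ⟩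
      ∣ q ∣ * d u + subsetSum q d     ∎

  ∣p∣*s≤2*∑∈ : 2 ≤ ∣ p ∣ → ∣ p ∣ * s ≤ 2 * subsetSum p d
  ∣p∣*s≤2*∑∈ 2≤∣p∣ with any? (λ u → (u ∈? p) ×-dec (2 * d u <? s))
  ... | yes (u , u∈p , 2du<s) = bound-if-low-vertex u∈p (<⇒≤ 2du<s) 2≤∣p∣
  ... | no ∄low = bound-if-all-high λ {u} u∈p → ≮⇒≥ λ 2du<s → ∄low (u , u∈p , 2du<s)

open PairwiseBound using (∣p∣*s≤2*∑∈)

neighbours : ∀ {n} → Graph n → Fin n → Subset n
neighbours G u = tabulate (adj G u)

deg≡∣neighbours∣ : ∀ {n} (G : Graph n) u → deg G u ≡ ∣ neighbours G u ∣
deg≡∣neighbours∣ G u = begin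
  deg G u                        ≡⟨ sum-allFin-if (adj G u) _ ⟩
  ∑[ _ ∈ neighbours G u ] 1      ≡⟨ ∑∈-const (neighbours G u) 1 ⟩
  ∣ neighbours G u ∣ * 1         ≡⟨ *-identityʳ _ ⟩
  ∣ neighbours G u ∣             ∎
  where open ≡-Reasoning

neighbours⊂⊤ : ∀ {n} (G : Graph n) u → neighbours G u ⊂ ⊤
neighbours⊂⊤ G u = (λ _ → ∈⊤) , u , ∈⊤ , u∉N[u]
  where
  u∉N[u] : u ∉ neighbours G u
  u∉N[u] u∈N[u] =
    not-¬ (irrefl G u) (trans (sym (lookup∘tabulate (adj G u) u)) ([]=⇒lookup u∈N[u]))

deg≤n∸1 : ∀ {n} (G : Graph n) u → deg G u ≤ n ∸ 1
deg≤n∸1 {n} G u = subst (deg G u ≤_) (pred[m∸n]≡m∸[1+n] n 0) (<⇒≤pred deg<n)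
  where
  deg<n : deg G u < n
  deg<n = subst₂ _<_ (sym (deg≡∣neighbours∣ G u)) (∣⊤∣≡n n) (p⊂q⇒∣p∣<∣q∣ (neighbours⊂⊤ G u))

weight≡∑deg : ∀ {n} (G : Graph n) I → weight G I ≡ ∑[ u ∈ I ] deg G u
weight≡∑deg G I =
  trans (sum-allFin-if (lookup I) (deg G)) (cong (λ p → subsetSum p (deg G)) (tabulate∘lookup I))

σ₂≤2[n∸1] : ∀ {n} (G : Graph n) {s} → IsSigma2 G s → s ≤ 2 * (n ∸ 1)
σ₂≤2[n∸1] {n} G {s} ((x , y , _ , _ , dx+dy≡s) , _) = begin
  s                     ≡⟨ dx+dy≡s ⟨
  deg G x + deg G y     ≤⟨ +-mono-≤ (deg≤n∸1 G x) (deg≤n∸1 G y) ⟩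
  (n ∸ 1) + (n ∸ 1)     ≡⟨ cong ((n ∸ 1) +_) (+-identityʳ (n ∸ 1)) ⟨
  2 * (n ∸ 1)           ∎
  where open ≤-Reasoning

-- Non-completeness already follows from σ₂ being attained, and δ ≥ 1 is only needed for
-- σ₂ > 0 in the paper's quotient form of the bound.
proposition2 : (n : ℕ) (G : Graph n) → ¬ IsComplete G → MinDegAtLeast G 1 →
    (a s : ℕ) → IsAlphaStar G a → IsSigma2 G s → a * s ≤ 2 * (n ∸ 1)
proposition2 n G _ _ 0 s _ _ = z≤n
proposition2 n G _ _ 1 s _ σ₂ = subst (_≤ 2 * (n ∸ 1)) (sym (*-identityˡ s)) (σ₂≤2[n∸1] G σ₂)
proposition2 n G _ _ a@(suc (suc _)) s
             ((I , ((_ , independent) , w≤n∸1) , ∣I∣≡a) , _) (_ , σ₂-minimal) = begin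
  a * s                     ≡⟨ cong (_* s) ∣I∣≡a ⟨
  ∣ I ∣ * s                 ≤⟨ ∣p∣*s≤2*∑∈ (deg G) I pairwise 2≤∣I∣ ⟩
  2 * (∑[ u ∈ I ] deg G u)  ≡⟨ cong (2 *_) (weight≡∑deg G I) ⟨
  2 * weight G I            ≤⟨ *-monoʳ-≤ 2 w≤n∸1 ⟩
  2 * (n ∸ 1)               ∎
  where
  open ≤-Reasoning
  pairwise : ∀ {u v} → u ∈ I → v ∈ I → u ≢ v → s ≤ deg G u + deg G v
  pairwise u∈I v∈I u≢v = σ₂-minimal _ _ u≢v (independent _ _ u∈I v∈I)
  2≤∣I∣ : 2 ≤ ∣ I ∣
  2≤∣I∣ = subst (2 ≤_) (sym ∣I∣≡a) (s≤s (s≤s z≤n))
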